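{- Let $p^n$ be a power of an odd prime $p$ ($n\ge1$), $r\in\mathbb{Z}/p^n\mathbb{Z}$ and $d\in(\mathbb{Z}/p^n\mathbb{Z})^*$. Then \[ |\{A\in M_{2\times2}(\mathbb{Z}/p^n\mathbb{Z}):\mathrm{tr}(A)=r,\ \det(A)=d\}|\le p^{2n}\left(1+\frac{3}{p}\right). \] -}

module Defs where

open import Data.Nat using (ℕ; zero; suc; _+_; _*_; _^_; NonZero)
open import Data.Nat.DivMod using (_mod_)
open import Data.Fin using (Fin; toℕ)
open import Data.Fin.Properties using (_≟_)
open import Data.Product using (_×_; _,_; ∃)
open import Data.List using (List; allFin; cartesianProduct; filter; length)
open import Relation.Nullary.Decidable using (_×-dec_)
open import Relation.Binary.PropositionalEquality using (_≡_)

-- ℤ/mℤ modelled as Fin m (residues 0..m-1), with ring operations mod m.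
ℤmod : ℕ → Set
ℤmod m = Fin m

infixl 6 _+ₘ_
infixl 7 _*ₘ_
infixl 6 _-ₘ_

_+ₘ_ : ∀ {m} .{{_ : NonZero m}} → Fin m → Fin m → Fin m
_+ₘ_ {m} x y = (toℕ x + toℕ y) mod m

_*ₘ_ : ∀ {m} .{{_ : NonZero m}} → Fin m → Fin m → Fin m
_*ₘ_ {m} x y = (toℕ x * toℕ y) mod m

-- subtraction: x - y = x + (m - y) mod m  (m - y ≥ 1 since y < m)
_-ₘ_ : ∀ {m} .{{_ : NonZero m}} → Fin m → Fin m → Fin m
_-ₘ_ {m} x y = (toℕ x + (m Data.Nat.∸ toℕ y)) mod m

oneₘ : ∀ {m} .{{_ : NonZero m}} → Fin m
oneₘ {m} = 1 mod m

IsUnit : ∀ {m} .{{_ : NonZero m}} → Fin m → Set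
IsUnit {m} d = ∃ λ (e : Fin m) → d *ₘ e ≡ oneₘ

-- 2×2 matrix [[a , b] , [c , d]] over ℤ/mℤ, as the tuple (a , b , c , d)
Mat2 : ℕ → Set
Mat2 m = Fin m × Fin m × Fin m × Fin m

tr : ∀ {m} .{{_ : NonZero m}} → Mat2 m → Fin m
tr (a , b , c , d) = a +ₘ d

det : ∀ {m} .{{_ : NonZero m}} → Mat2 m → Fin m
det (a , b , c , d) = (a *ₘ d) -ₘ (b *ₘ c)

allMat2 : ∀ m → List (Mat2 m)
allMat2 m = cartesianProduct (allFin m)
             (cartesianProduct (allFin m) (cartesianProduct (allFin m) (allFin m)))

countTrDet : ∀ m .{{_ : NonZero m}} → Fin m → Fin m → ℕ
countTrDet m r d = length (filter (λ A → (tr A ≟ r) ×-dec (det A ≟ d)) (allMat2 m))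

-- Completing the square, (a + e)² − 4(ae − bc) = (a − e)² + 4bc, so a matrix
-- [[a, b], [c, e]] with trace r and determinant d gives a solution (x, b, c) = (a − e, b, c)
-- of x² + 4bc ≡ r² − 4d (mod pⁿ); as 2 is invertible, a + e ≡ r and a − e determine a
-- and e, so there are at most as many matrices as solutions (MatrixCount).  The number of
-- solutions of x² + 4yz ≡ t (mod pᵏ) is bounded, for every t, by induction on k
-- (QuadraticCount): sorting solutions by which of y, z, x is first a unit, the congruence
-- is linear with unit coefficient in z (p ∤ y) or in y (p ∤ z), has at most two roots x
-- (p ∤ x), and when p divides x, y, z it forces p² ∣ t and descends to x² + 4yz ≡ t/p²
-- (mod pᵏ⁻²).

module Submission where

module FiniteSums where

  open import Data.Nat
  open import Data.Nat.Properties
  open import Data.Nat.Divisibility using (_∣_; >⇒∤; ∣m+n∣m⇒∣n; ∣-refl)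
  open import Data.Nat.Tactic.RingSolver using (solve-∀)
  open import Data.Fin using (Fin; toℕ) renaming (zero to fzero; suc to fsuc)
  open import Data.List using (List; []; _∷_; _++_; map; filter; length; cartesianProduct; tabulate; allFin)
  open import Data.Product using (∃; _×_; _,_)
  open import Data.Sum using (_⊎_; inj₁; inj₂)
  open import Data.Empty using (⊥-elim)
  open import Function using (_∘_)
  open import Relation.Nullary using (Dec; yes; no; ¬_)
  open import Relation.Nullary.Decidable using (_×-dec_)
  open import Relation.Binary.PropositionalEquality

  ∑ : ℕ → (ℕ → ℕ) → ℕ
  ∑ zero    f = 0
  ∑ (suc n) f = f 0 + ∑ n (f ∘ suc)

  ∑-cong : ∀ n {f g} → (∀ i → i < n → f i ≡ g i) → ∑ n f ≡ ∑ n g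
  ∑-cong zero    f≡g = refl
  ∑-cong (suc n) f≡g = cong₂ _+_ (f≡g 0 z<s) (∑-cong n (λ i i<n → f≡g (suc i) (s<s i<n)))

  ∑-mono : ∀ n {f g} → (∀ i → i < n → f i ≤ g i) → ∑ n f ≤ ∑ n g
  ∑-mono zero    f≤g = z≤n
  ∑-mono (suc n) f≤g = +-mono-≤ (f≤g 0 z<s) (∑-mono n (λ i i<n → f≤g (suc i) (s<s i<n)))

  ∑-const : ∀ n c → ∑ n (λ _ → c) ≡ n * c
  ∑-const zero    c = refl
  ∑-const (suc n) c = cong (c +_) (∑-const n c)

  ∑-zero : ∀ n → ∑ n (λ _ → 0) ≡ 0
  ∑-zero n = trans (∑-const n 0) (*-zeroʳ n)

  ∑-distrib-+ : ∀ n f g → ∑ n (λ i → f i + g i) ≡ ∑ n f + ∑ n g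
  ∑-distrib-+ zero    f g = refl
  ∑-distrib-+ (suc n) f g =
    trans (cong (f 0 + g 0 +_) (∑-distrib-+ n (f ∘ suc) (g ∘ suc))) (interchange (f 0) (g 0) _ _)
    where
    interchange : ∀ a b c d → (a + b) + (c + d) ≡ (a + c) + (b + d)
    interchange = solve-∀

  ∑-*ˡ : ∀ n c f → ∑ n (λ i → c * f i) ≡ c * ∑ n f
  ∑-*ˡ zero    c f = sym (*-zeroʳ c)
  ∑-*ˡ (suc n) c f = trans (cong (c * f 0 +_) (∑-*ˡ n c (f ∘ suc))) (sym (*-distribˡ-+ c (f 0) _))

  ∑-*ʳ : ∀ n c f → ∑ n (λ i → f i * c) ≡ ∑ n f * c
  ∑-*ʳ n c f = trans (∑-cong n (λ i _ → *-comm (f i) c)) (trans (∑-*ˡ n c f) (*-comm c _))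

  ∑-swap : ∀ n m (f : ℕ → ℕ → ℕ) → ∑ n (λ i → ∑ m (f i)) ≡ ∑ m (λ j → ∑ n (λ i → f i j))
  ∑-swap zero    m f = sym (∑-zero m)
  ∑-swap (suc n) m f =
    trans (cong (∑ m (f 0) +_) (∑-swap n m (f ∘ suc)))
          (sym (∑-distrib-+ m (f 0) (λ j → ∑ n (λ i → f (suc i) j))))

  ∑-split : ∀ a b f → ∑ (a + b) f ≡ ∑ a f + ∑ b (λ i → f (a + i))
  ∑-split zero    b f = refl
  ∑-split (suc a) b f = trans (cong (f 0 +_) (∑-split a b (f ∘ suc))) (sym (+-assoc (f 0) _ _))

  ∑-periodic : ∀ k q f → (∀ i → f (q + i) ≡ f i) → ∑ (k * q) f ≡ k * ∑ q f
  ∑-periodic zero    q f per = refl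
  ∑-periodic (suc k) q f per =
    trans (∑-split q (k * q) f)
          (cong (∑ q f +_) (trans (∑-cong (k * q) (λ i _ → per i)) (∑-periodic k q f per)))

  ∑-multiples : ∀ k q .{{_ : NonZero q}} f → (∀ i → ¬ (q ∣ i) → f i ≡ 0) →
                ∑ (k * q) f ≡ ∑ k (λ i → f (i * q))
  ∑-multiples zero    q f vanish = refl
  ∑-multiples (suc k) q@(suc q′) f vanish = begin
    ∑ (q + k * q) f                               ≡⟨ ∑-split q (k * q) f ⟩
    f 0 + ∑ q′ (f ∘ suc) + ∑ (k * q) (f ∘ (q +_)) ≡⟨ cong (λ s → f 0 + s + ∑ (k * q) (f ∘ (q +_))) inside ⟩
    f 0 + 0 + ∑ (k * q) (f ∘ (q +_))              ≡⟨ cong (_+ ∑ (k * q) (f ∘ (q +_))) (+-identityʳ (f 0)) ⟩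
    f 0 + ∑ (k * q) (f ∘ (q +_))                  ≡⟨ cong (f 0 +_) (∑-multiples k q (f ∘ (q +_)) shifted) ⟩
    f 0 + ∑ k (λ i → f (q + i * q))               ∎
    where
    open ≡-Reasoning
    inside : ∑ q′ (f ∘ suc) ≡ 0
    inside = trans (∑-cong q′ (λ i i<q′ → vanish (suc i) (>⇒∤ (s<s i<q′)))) (∑-zero q′)
    shifted : ∀ i → ¬ (q ∣ i) → f (q + i) ≡ 0
    shifted i q∤i = vanish (q + i) (λ q∣q+i → q∤i (∣m+n∣m⇒∣n q∣q+i ∣-refl))

  ∑-term : ∀ n f u → u < n → f u ≤ ∑ n f
  ∑-term (suc n) f zero    _         = m≤m+n (f 0) _
  ∑-term (suc n) f (suc u) (s<s u<n) = ≤-trans (∑-term n (f ∘ suc) u u<n) (m≤n+m _ (f 0))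

  ⟦_⟧ : ∀ {P : Set} → Dec P → ℕ
  ⟦ yes _ ⟧ = 1
  ⟦ no  _ ⟧ = 0

  ⟦⟧-yes : ∀ {P : Set} → P → (P? : Dec P) → ⟦ P? ⟧ ≡ 1
  ⟦⟧-yes p (yes _) = refl
  ⟦⟧-yes p (no ¬p) = ⊥-elim (¬p p)

  ⟦⟧-no : ∀ {P : Set} → ¬ P → (P? : Dec P) → ⟦ P? ⟧ ≡ 0
  ⟦⟧-no ¬p (yes p) = ⊥-elim (¬p p)
  ⟦⟧-no ¬p (no _)  = refl

  ⟦⟧-≥1 : ∀ {P : Set} (P? : Dec P) → P → 1 ≤ ⟦ P? ⟧
  ⟦⟧-≥1 P? p = ≤-reflexive (sym (⟦⟧-yes p P?))

  ⟦⟧-≤-when : ∀ {P : Set} {n} → (P → 1 ≤ n) → (P? : Dec P) → ⟦ P? ⟧ ≤ n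
  ⟦⟧-≤-when P⇒1≤n (yes p) = P⇒1≤n p
  ⟦⟧-≤-when P⇒1≤n (no _)  = z≤n

  ⟦⟧-cover₄ : ∀ {P Q R S : Set} (P? : Dec P) (Q? : Dec Q) (R? : Dec R) (S? : Dec S) →
              P ⊎ Q ⊎ R ⊎ S → 1 ≤ ⟦ P? ⟧ + (⟦ Q? ⟧ + (⟦ R? ⟧ + ⟦ S? ⟧))
  ⟦⟧-cover₄ (yes _) _       _       _       _                      = s≤s z≤n
  ⟦⟧-cover₄ (no _)  (yes _) _       _       _                      = s≤s z≤n
  ⟦⟧-cover₄ (no _)  (no _)  (yes _) _       _                      = s≤s z≤n
  ⟦⟧-cover₄ (no _)  (no _)  (no _)  (yes _) _                      = s≤s z≤n
  ⟦⟧-cover₄ (no ¬p) (no _)  (no _)  (no _)  (inj₁ p)               = ⊥-elim (¬p p)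
  ⟦⟧-cover₄ (no _)  (no ¬q) (no _)  (no _)  (inj₂ (inj₁ q))        = ⊥-elim (¬q q)
  ⟦⟧-cover₄ (no _)  (no _)  (no ¬r) (no _)  (inj₂ (inj₂ (inj₁ r))) = ⊥-elim (¬r r)
  ⟦⟧-cover₄ (no _)  (no _)  (no _)  (no ¬s) (inj₂ (inj₂ (inj₂ s))) = ⊥-elim (¬s s)

  ⟦⟧-≤1 : ∀ {P : Set} (P? : Dec P) → ⟦ P? ⟧ ≤ 1
  ⟦⟧-≤1 (yes _) = ≤-refl
  ⟦⟧-≤1 (no _)  = z≤n

  ⟦⟧-mono : ∀ {P Q : Set} → (P → Q) → (P? : Dec P) (Q? : Dec Q) → ⟦ P? ⟧ ≤ ⟦ Q? ⟧
  ⟦⟧-mono P⇒Q (yes p) Q? = ≤-reflexive (sym (⟦⟧-yes (P⇒Q p) Q?))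
  ⟦⟧-mono P⇒Q (no _)  Q? = z≤n

  ⟦⟧-cong : ∀ {P Q : Set} → (P → Q) → (Q → P) → (P? : Dec P) (Q? : Dec Q) → ⟦ P? ⟧ ≡ ⟦ Q? ⟧
  ⟦⟧-cong P⇒Q Q⇒P P? Q? = ≤-antisym (⟦⟧-mono P⇒Q P? Q?) (⟦⟧-mono Q⇒P Q? P?)

  ⟦⟧-× : ∀ {P Q : Set} (P? : Dec P) (Q? : Dec Q) → ⟦ P? ×-dec Q? ⟧ ≡ ⟦ P? ⟧ * ⟦ Q? ⟧
  ⟦⟧-× (yes _) (yes _) = refl
  ⟦⟧-× (yes _) (no _)  = refl
  ⟦⟧-× (no _)  Q?      = refl

  #_<_ : ∀ {P : ℕ → Set} → (∀ i → Dec (P i)) → ℕ → ℕ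
  # P? < n = ∑ n (λ i → ⟦ P? i ⟧)

  count-none : ∀ n {P : ℕ → Set} (P? : ∀ i → Dec (P i)) → (∀ i → i < n → ¬ P i) → # P? < n ≡ 0
  count-none n P? none = trans (∑-cong n (λ i i<n → ⟦⟧-no (none i i<n) (P? i))) (∑-zero n)

  count-unique : ∀ n {P : ℕ → Set} (P? : ∀ i → Dec (P i)) →
                 (∀ i j → i < n → j < n → P i → P j → i ≡ j) → # P? < n ≤ 1
  count-unique zero    P? unique = z≤n
  count-unique (suc n) P? unique with P? 0
  ... | yes p0 = ≤-reflexive (cong suc (count-none n (P? ∘ suc)
                   (λ i i<n pi → 0≢1+n (unique 0 (suc i) z<s (s<s i<n) p0 pi))))
  ... | no _   = count-unique n (P? ∘ suc)
                   (λ i j i<n j<n pi pj → suc-injective (unique (suc i) (suc j) (s<s i<n) (s<s j<n) pi pj))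

  count-unique-if : ∀ n {P : ℕ → Set} {R : Set} (P? : ∀ i → Dec (P i)) (R? : Dec R) →
                    (∀ i j → i < n → j < n → P i → P j → i ≡ j) → (∀ i → i < n → P i → R) →
                    # P? < n ≤ ⟦ R? ⟧
  count-unique-if n P? (yes _) unique _  = count-unique n P? unique
  count-unique-if n P? (no ¬r) unique ⇒R = ≤-reflexive (count-none n P? (λ i i<n pi → ¬r (⇒R i i<n pi)))

  search : ∀ n {P : ℕ → Set} (P? : ∀ i → Dec (P i)) → (∃ λ u → u < n × P u) ⊎ (∀ i → i < n → ¬ P i)
  search zero    P? = inj₂ (λ i ())
  search (suc n) P? with P? 0 | search n (P? ∘ suc)
  ... | yes p0 | _                   = inj₁ (0 , z<s , p0)
  ... | no _   | inj₁ (u , u<n , pu) = inj₁ (suc u , s<s u<n , pu)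
  ... | no ¬p0 | inj₂ none           = inj₂ λ { zero _ → ¬p0 ; (suc i) (s<s i<n) → none i i<n }

  count-two : ∀ n {P : ℕ → Set} (P? : ∀ i → Dec (P i)) (g : ℕ → ℕ) →
              (∀ u i → u < n → i < n → P u → P i → i ≡ u ⊎ i ≡ g u) → # P? < n ≤ 2
  count-two n P? g twoRoots with search n P?
  ... | inj₂ none          = ≤-trans (≤-reflexive (count-none n P? none)) z≤n
  ... | inj₁ (u , u<n , pu) = begin
    # P? < n                                               ≤⟨ ∑-mono n covered ⟩
    ∑ n (λ i → ⟦ i ≟ u ⟧ + ⟦ i ≟ g u ⟧)                     ≡⟨ ∑-distrib-+ n _ _ ⟩
    # (_≟ u) < n + # (_≟ g u) < n                          ≤⟨ +-mono-≤ (single u) (single (g u)) ⟩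
    2                                                      ∎
    where
    open ≤-Reasoning
    single : ∀ v → # (_≟ v) < n ≤ 1
    single v = count-unique n (_≟ v) (λ i j _ _ i≡v j≡v → trans i≡v (sym j≡v))
    covered : ∀ i → i < n → ⟦ P? i ⟧ ≤ ⟦ i ≟ u ⟧ + ⟦ i ≟ g u ⟧
    covered i i<n with P? i
    ... | no _  = z≤n
    ... | yes pi with twoRoots u i u<n i<n pu pi
    ...   | inj₁ i≡u  = ≤-trans (≤-reflexive (sym (⟦⟧-yes i≡u (i ≟ u)))) (m≤m+n _ _)
    ...   | inj₂ i≡gu = ≤-trans (≤-reflexive (sym (⟦⟧-yes i≡gu (i ≟ g u)))) (m≤n+m _ _)

  ∑ᴸ : ∀ {A : Set} → List A → (A → ℕ) → ℕ
  ∑ᴸ []       f = 0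
  ∑ᴸ (x ∷ xs) f = f x + ∑ᴸ xs f

  length-filter : ∀ {A : Set} {P : A → Set} (P? : ∀ x → Dec (P x)) xs →
                  length (filter P? xs) ≡ ∑ᴸ xs (λ x → ⟦ P? x ⟧)
  length-filter P? []       = refl
  length-filter P? (x ∷ xs) with P? x
  ... | yes _ = cong suc (length-filter P? xs)
  ... | no _  = length-filter P? xs

  ∑ᴸ-mono : ∀ {A : Set} (xs : List A) {f g} → (∀ x → f x ≤ g x) → ∑ᴸ xs f ≤ ∑ᴸ xs g
  ∑ᴸ-mono []       f≤g = z≤n
  ∑ᴸ-mono (x ∷ xs) f≤g = +-mono-≤ (f≤g x) (∑ᴸ-mono xs f≤g)

  ∑ᴸ-++ : ∀ {A : Set} (xs ys : List A) f → ∑ᴸ (xs ++ ys) f ≡ ∑ᴸ xs f + ∑ᴸ ys f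
  ∑ᴸ-++ []       ys f = refl
  ∑ᴸ-++ (x ∷ xs) ys f = trans (cong (f x +_) (∑ᴸ-++ xs ys f)) (sym (+-assoc (f x) _ _))

  ∑ᴸ-map : ∀ {A B : Set} (g : A → B) xs f → ∑ᴸ (map g xs) f ≡ ∑ᴸ xs (f ∘ g)
  ∑ᴸ-map g []       f = refl
  ∑ᴸ-map g (x ∷ xs) f = cong (f (g x) +_) (∑ᴸ-map g xs f)

  ∑ᴸ-cartesianProduct : ∀ {A B : Set} (xs : List A) (ys : List B) f →
                        ∑ᴸ (cartesianProduct xs ys) f ≡ ∑ᴸ xs (λ x → ∑ᴸ ys (λ y → f (x , y)))
  ∑ᴸ-cartesianProduct []       ys f = refl
  ∑ᴸ-cartesianProduct (x ∷ xs) ys f =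
    trans (∑ᴸ-++ (map (x ,_) ys) _ f) (cong₂ _+_ (∑ᴸ-map (x ,_) ys f) (∑ᴸ-cartesianProduct xs ys f))

  ∑ᴸ-allFin : ∀ n (h : ℕ → ℕ) → ∑ᴸ (allFin n) (h ∘ toℕ) ≡ ∑ n h
  ∑ᴸ-allFin n h = tab n (λ i → i) (h ∘ toℕ) h (λ _ → refl)
    where
    tab : ∀ {A : Set} n (g : Fin n → A) (f : A → ℕ) (h : ℕ → ℕ) →
          (∀ i → f (g i) ≡ h (toℕ i)) → ∑ᴸ (tabulate g) f ≡ ∑ n h
    tab zero    g f h e = refl
    tab (suc n) g f h e = cong₂ _+_ (e fzero) (tab n (g ∘ fsuc) f (h ∘ suc) (e ∘ fsuc))

  ∑ᴸ-allFin-× : ∀ n {B : Set} (ys : List B) (F : ℕ → B → ℕ) →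
                ∑ᴸ (cartesianProduct (allFin n) ys) (λ (a , y) → F (toℕ a) y) ≡ ∑ n (λ a → ∑ᴸ ys (F a))
  ∑ᴸ-allFin-× n ys F = trans (∑ᴸ-cartesianProduct (allFin n) ys _) (∑ᴸ-allFin n (λ a → ∑ᴸ ys (F a)))

  ∑³ : ℕ → (ℕ → ℕ → ℕ → ℕ) → ℕ
  ∑³ n f = ∑ n λ x → ∑ n λ y → ∑ n λ z → f x y z

  ∑³-mono : ∀ n {f g} → (∀ x y z → x < n → y < n → z < n → f x y z ≤ g x y z) → ∑³ n f ≤ ∑³ n g
  ∑³-mono n f≤g = ∑-mono n λ x x<n → ∑-mono n λ y y<n → ∑-mono n λ z z<n → f≤g x y z x<n y<n z<n

  ∑³-cong : ∀ n {f g} → (∀ x y z → x < n → y < n → z < n → f x y z ≡ g x y z) → ∑³ n f ≡ ∑³ n g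
  ∑³-cong n f≡g = ∑-cong n λ x x<n → ∑-cong n λ y y<n → ∑-cong n λ z z<n → f≡g x y z x<n y<n z<n

  ∑³-zero : ∀ n f → (∀ x y z → x < n → y < n → z < n → f x y z ≡ 0) → ∑³ n f ≡ 0
  ∑³-zero n f f≡0 =
    trans (∑³-cong n f≡0) (trans (∑-cong n (λ x _ → trans (∑-cong n (λ y _ → ∑-zero n)) (∑-zero n))) (∑-zero n))

  ∑³-distrib-+ : ∀ n f g → ∑³ n (λ x y z → f x y z + g x y z) ≡ ∑³ n f + ∑³ n g
  ∑³-distrib-+ n f g =
    trans (∑-cong n (λ x _ → trans (∑-cong n (λ y _ → ∑-distrib-+ n _ _)) (∑-distrib-+ n _ _))) (∑-distrib-+ n _ _)

  ∑³-swap-yz : ∀ n f → ∑³ n f ≡ ∑ n (λ x → ∑ n (λ z → ∑ n (λ y → f x y z)))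
  ∑³-swap-yz n f = ∑-cong n (λ x _ → ∑-swap n n (f x))

  ∑³-rotate : ∀ n f → ∑³ n f ≡ ∑ n (λ y → ∑ n (λ z → ∑ n (λ x → f x y z)))
  ∑³-rotate n f =
    trans (∑-swap n n (λ x y → ∑ n (f x y))) (∑-cong n (λ y _ → ∑-swap n n (λ x z → f x y z)))

  ∑³-product : ∀ n a → ∑³ n (λ x y z → a x * (a y * a z)) ≡ ∑ n a * (∑ n a * ∑ n a)
  ∑³-product n a =
    trans (∑-cong n (λ x _ → trans (∑-cong n (λ y _ → trans (∑-*ˡ n (a x) _) (cong (a x *_) (∑-*ˡ n (a y) a))))
                                    (trans (∑-*ˡ n (a x) _) (cong (a x *_) (∑-*ʳ n (∑ n a) a)))))
          (∑-*ʳ n _ a)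

  ∑³-periodic : ∀ k q (g : ℕ → ℕ → ℕ → ℕ) →
                (∀ x y z → g (q + x) y z ≡ g x y z) → (∀ x y z → g x (q + y) z ≡ g x y z) →
                (∀ x y z → g x y (q + z) ≡ g x y z) → ∑³ (k * q) g ≡ k * (k * (k * ∑³ q g))
  ∑³-periodic k q g per-x per-y per-z =
    trans (∑-cong (k * q) (λ x _ → inner x))
          (trans (∑-*ˡ (k * q) k _) (cong (k *_) (trans (∑-*ˡ (k * q) k _)
            (cong (k *_) (∑-periodic k q _ (λ x → ∑-cong q (λ y _ → ∑-cong q (λ z _ → per-x x y z))))))))
    where
    inner : ∀ x → ∑ (k * q) (λ y → ∑ (k * q) (g x y)) ≡ k * (k * ∑ q (λ y → ∑ q (g x y)))
    inner x = trans (∑-cong (k * q) (λ y _ → ∑-periodic k q (g x y) (per-z x y)))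
                    (trans (∑-*ˡ (k * q) k _) (cong (k *_) (∑-periodic k q _ (λ y → ∑-cong q (λ z _ → per-y x y z)))))

  ∑³-multiples : ∀ k q .{{_ : NonZero q}} (g : ℕ → ℕ → ℕ → ℕ) →
                 (∀ x y z → ¬ (q ∣ x) ⊎ ¬ (q ∣ y) ⊎ ¬ (q ∣ z) → g x y z ≡ 0) →
                 ∑³ (k * q) g ≡ ∑³ k (λ x y z → g (x * q) (y * q) (z * q))
  ∑³-multiples k q g vanish =
    trans (∑-multiples k q _ (λ x q∤x → ∑-zero-by (λ y → ∑-zero-by (λ z → vanish x y z (inj₁ q∤x)))))
          (∑-cong k (λ x _ → trans (∑-multiples k q _ (λ y q∤y → ∑-zero-by (λ z → vanish (x * q) y z (inj₂ (inj₁ q∤y)))))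
            (∑-cong k (λ y _ → ∑-multiples k q _ (λ z q∤z → vanish (x * q) (y * q) z (inj₂ (inj₂ q∤z)))))))
    where
    ∑-zero-by : ∀ {f} → (∀ i → f i ≡ 0) → ∑ (k * q) f ≡ 0
    ∑-zero-by f≡0 = trans (∑-cong (k * q) (λ i _ → f≡0 i)) (∑-zero (k * q))

module Congruences where

  open import Data.Nat as ℕ using (ℕ; zero; suc; NonZero; _<_; _≤_; _^_)
  import Data.Nat.Properties as ℕ
  import Data.Nat.Divisibility as ℕ
  open import Data.Nat.Primality using (Prime; euclidsLemma; prime⇒nonZero; prime⇒nonTrivial)
  open import Data.Integer as ℤ using (ℤ; +_; _+_; _-_; _*_; -_)
  open import Data.Integer.Properties using (abs-*; m-n≡m⊖n; ∣⊖∣-≤; ⊖-≥)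
  open import Data.Integer.Divisibility.Signed
  open import Data.Integer.DivMod using (_%ℕ_; _/ℕ_; a≡a%ℕn+[a/ℕn]*n; n%ℕd<d)
  open import Data.Integer.Tactic.RingSolver using (solve-∀)
  open import Data.Product using (∃; _×_; _,_)
  open import Data.Sum using (_⊎_; inj₁; inj₂)
  open import Relation.Nullary using (¬_; contradiction)
  open import Relation.Binary.PropositionalEquality

  ∣-by-sub : ∀ {k a b c} → k ∣ a → k ∣ b → a - b ≡ c → k ∣ c
  ∣-by-sub {k} k∣a k∣b eq = subst (k ∣_) eq (∣m∣n⇒∣m-n k∣a k∣b)

  ∣-by-add : ∀ {k a b c} → k ∣ a → k ∣ b → a + b ≡ c → k ∣ c
  ∣-by-add {k} k∣a k∣b eq = subst (k ∣_) eq (∣m∣n⇒∣m+n k∣a k∣b)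

  ∣-* : ∀ {k l a b} → k ∣ a → l ∣ b → k * l ∣ a * b
  ∣-* {k} {l} {a} {b} k∣a l∣b =
    ∣ᵤ⇒∣ (subst₂ ℕ._∣_ (sym (abs-* k l)) (sym (abs-* a b)) (ℕ.*-pres-∣ (∣⇒∣ᵤ k∣a) (∣⇒∣ᵤ l∣b)))

  euclid : ∀ {p} → Prime p → ∀ a b → + p ∣ a * b → + p ∣ a ⊎ + p ∣ b
  euclid {p} p-prime a b p∣ab with euclidsLemma ℤ.∣ a ∣ ℤ.∣ b ∣ p-prime (subst (p ℕ.∣_) (abs-* a b) (∣⇒∣ᵤ p∣ab))
  ... | inj₁ p∣a = inj₁ (∣ᵤ⇒∣ p∣a)
  ... | inj₂ p∣b = inj₂ (∣ᵤ⇒∣ p∣b)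

  prime∤* : ∀ {p} → Prime p → ∀ {a b} → ¬ (+ p ∣ a) → ¬ (+ p ∣ b) → ¬ (+ p ∣ a * b)
  prime∤* p-prime {a} {b} p∤a p∤b p∣ab with euclid p-prime a b p∣ab
  ... | inj₁ p∣a = p∤a p∣a
  ... | inj₂ p∣b = p∤b p∣b

  prime∣square : ∀ {p} → Prime p → ∀ {x} → + p ∣ x * x → + p ∣ x
  prime∣square p-prime {x} p∣x² with euclid p-prime x x p∣x²
  ... | inj₁ p∣x = p∣x
  ... | inj₂ p∣x = p∣x

  odd-prime∤2 : ∀ {p} → Prime p → ¬ (p ≡ 2) → ¬ (+ p ∣ + 2)
  odd-prime∤2 {p} p-prime p≢2 p∣2 =
    p≢2 (ℕ.≤-antisym (ℕ.∣⇒≤ (∣⇒∣ᵤ p∣2)) (ℕ.nonTrivial⇒n>1 p {{prime⇒nonTrivial p-prime}}))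

  prime-power-cancel : ∀ {p} → Prime p → ∀ {a} → ¬ (+ p ∣ a) → ∀ k {b} →
                       + (p ^ k) ∣ a * b → + (p ^ k) ∣ b
  prime-power-cancel {p} p-prime {a} p∤a k {b} pᵏ∣ab =
    ∣ᵤ⇒∣ (natural k (subst (p ^ k ℕ.∣_) (abs-* a b) (∣⇒∣ᵤ pᵏ∣ab)))
    where
    instance
      p≢0 : NonZero p
      p≢0 = prime⇒nonZero p-prime
    p∤∣a∣ : ¬ (p ℕ.∣ ℤ.∣ a ∣)
    p∤∣a∣ p∣a = p∤a (∣ᵤ⇒∣ p∣a)
    natural : ∀ k {c} → p ^ k ℕ.∣ ℤ.∣ a ∣ ℕ.* c → p ^ k ℕ.∣ c
    natural zero    _ = ℕ.1∣ _
    natural (suc k) {c} pᵏ⁺¹∣ac with euclidsLemma ℤ.∣ a ∣ c p-prime (ℕ.∣-trans (ℕ.m∣m*n (p ^ k)) pᵏ⁺¹∣ac)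
    ... | inj₁ p∣a = contradiction p∣a p∤∣a∣
    ... | inj₂ (ℕ.divides c′ refl) =
      subst (p ℕ.* p ^ k ℕ.∣_) (ℕ.*-comm p c′)
        (ℕ.*-monoʳ-∣ p (natural k (ℕ.*-cancelˡ-∣ p (subst (p ℕ.* p ^ k ℕ.∣_) (regroup ℤ.∣ a ∣ c′ p) pᵏ⁺¹∣ac))))
      where
      open import Data.Nat.Tactic.RingSolver renaming (solve-∀ to solve-ℕ)
      regroup : ∀ a c p → a ℕ.* (c ℕ.* p) ≡ p ℕ.* (a ℕ.* c)
      regroup = solve-ℕ

  private
    residue-unique-≤ : ∀ m x y → x ≤ y → y < m → + m ∣ (+ x - + y) → x ≡ y
    residue-unique-≤ m x y x≤y y<m m∣x-y =
      ℕ.≤-antisym x≤y (ℕ.m∸n≡0⇒m≤n (small m∣y∸x (ℕ.≤-<-trans (ℕ.m∸n≤m y x) y<m)))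
      where
      m∣y∸x : m ℕ.∣ (y ℕ.∸ x)
      m∣y∸x = subst (m ℕ.∣_) (trans (cong ℤ.∣_∣ (m-n≡m⊖n x y)) (∣⊖∣-≤ x≤y)) (∣⇒∣ᵤ m∣x-y)
      small : ∀ {n} → m ℕ.∣ n → n < m → n ≡ 0
      small {zero}  _   _   = refl
      small {suc n} m∣n n<m = contradiction m∣n (ℕ.>⇒∤ n<m)

  residue-unique : ∀ m x y → x < m → y < m → + m ∣ (+ x - + y) → x ≡ y
  residue-unique m x y x<m y<m m∣x-y with ℕ.≤-total x y
  ... | inj₁ x≤y = residue-unique-≤ m x y x≤y y<m m∣x-y
  ... | inj₂ y≤x = sym (residue-unique-≤ m y x y≤x x<m (subst (+ m ∣_) (negate-difference (+ x) (+ y)) (∣m⇒∣-m m∣x-y)))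
    where
    negate-difference : ∀ x y → - (x - y) ≡ y - x
    negate-difference = solve-∀

  residue-zero : ∀ m x → x < m → + m ∣ + x → x ≡ 0
  residue-zero m x x<m m∣x =
    residue-unique m x 0 x<m (ℕ.≤-<-trans ℕ.z≤n x<m) (subst (+ m ∣_) (cong +_ (sym (ℕ.+-identityʳ x))) m∣x)

  residue : ∀ m .{{_ : NonZero m}} z → ∃ λ x → x < m × + m ∣ (+ x - z)
  residue m z = z %ℕ m , n%ℕd<d z m , divides (- (z /ℕ m)) (quotient-form {+ (z %ℕ m)} {z /ℕ m} (a≡a%ℕn+[a/ℕn]*n z m))
    where
    quotient-form : ∀ {r q} → z ≡ r + q * + m → r - z ≡ (- q) * + m
    quotient-form {r} {q} refl = identity r q (+ m)
      where
      identity : ∀ r q m → r - (r + q * m) ≡ (- q) * m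
      identity = solve-∀

  residue-of-negation : ∀ n x u → x < n → u < n → + n ∣ (+ x + + u) → x ≡ u ⊎ x ≡ n ℕ.∸ u
  residue-of-negation n x zero    x<n u<n n∣x+u = inj₁ (residue-unique n x 0 x<n u<n n∣x+u)
  residue-of-negation n x (suc u) x<n u<n n∣x+u = inj₂ (residue-unique n x (n ℕ.∸ suc u) x<n n-u<n n∣x-[n-u])
    where
    n-u<n : n ℕ.∸ suc u < n
    n-u<n = ℕ.∸-monoʳ-< {n} {suc u} {0} ℕ.z<s (ℕ.<⇒≤ u<n)
    n-u≡ : + (n ℕ.∸ suc u) ≡ + n - + suc u
    n-u≡ = sym (trans (m-n≡m⊖n n (suc u)) (⊖-≥ (ℕ.<⇒≤ u<n)))
    identity : ∀ x u n → (x + u) - n ≡ x - (n - u)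
    identity = solve-∀
    n∣x-[n-u] : + n ∣ (+ x - + (n ℕ.∸ suc u))
    n∣x-[n-u] = subst (λ w → + n ∣ (+ x - w)) (sym n-u≡) (∣-by-sub n∣x+u ∣-refl (identity (+ x) (+ suc u) (+ n)))

module BoundArithmetic where

  open import Data.Nat
  open import Data.Nat.Properties
  open import Data.Nat.Tactic.RingSolver using (solve-∀)
  open import Relation.Binary.PropositionalEquality

  ^-double : ∀ p k → p ^ (2 * k) ≡ p ^ k * p ^ k
  ^-double p k = trans (cong (λ e → p ^ (k + e)) (+-identityʳ k)) (^-distribˡ-+-* p k k)

  -- The inequalities closing the three cases of the bound on solutions modulo m = p N:
  -- the class sizes, summed and multiplied by p, stay below m² (p + 3).

  -- p ∤ t:  (m² + 2mN + 2N²) p ≤ m² (p + 3), using 2 ≤ p.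
  unit-case-arith : ∀ p N → 2 ≤ p →
    (p * N * (p * N) + (p * N * (N * 2) + (2 * (N * N) + 0))) * p ≤ p * N * (p * N) * (p + 3)
  unit-case-arith p N 2≤p = begin
    (p * N * (p * N) + (p * N * (N * 2) + (2 * (N * N) + 0))) * p ≡⟨ expand p N ⟩
    X + 2 * (p * (N * N))                                       ≤⟨ +-monoʳ-≤ X (*-monoˡ-≤ (p * (N * N)) 2≤p) ⟩
    X + p * (p * (N * N))                                       ≡⟨ collect p N ⟩
    p * N * (p * N) * (p + 3)                                   ∎
    where
    open ≤-Reasoning
    X : ℕ
    X = p * p * p * (N * N) + 2 * (p * p * (N * N))
    expand : ∀ p N → (p * N * (p * N) + (p * N * (N * 2) + (2 * (N * N) + 0))) * p
                     ≡ p * p * p * (N * N) + 2 * (p * p * (N * N)) + 2 * (p * (N * N))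
    expand = solve-∀
    collect : ∀ p N → p * p * p * (N * N) + 2 * (p * p * (N * N)) + p * (p * (N * N)) ≡ p * N * (p * N) * (p + 3)
    collect = solve-∀

  -- p ∣ t, m = p:  (p² + p + 1) p ≤ p² (p + 3), using 1 ≤ p.
  base-case-arith : ∀ p → 1 ≤ p →
    (p * 1 * (p * 1) + (p * 1 * (1 * 1) + (0 + 1 * (1 * 1)))) * p ≤ p * 1 * (p * 1) * (p + 3)
  base-case-arith p 1≤p = begin
    (p * 1 * (p * 1) + (p * 1 * (1 * 1) + (0 + 1 * (1 * 1)))) * p ≡⟨ expand p ⟩
    X + 1 * p                                                   ≤⟨ +-monoʳ-≤ X (*-monoˡ-≤ p 1≤p) ⟩
    X + p * p                                                   ≤⟨ +-monoʳ-≤ X (m≤m+n (p * p) (p * p)) ⟩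
    X + (p * p + p * p)                                         ≡⟨ collect p ⟩
    p * 1 * (p * 1) * (p + 3)                                   ∎
    where
    open ≤-Reasoning
    X : ℕ
    X = p * p * p + p * p
    expand : ∀ p → (p * 1 * (p * 1) + (p * 1 * (1 * 1) + (0 + 1 * (1 * 1)))) * p ≡ p * p * p + p * p + 1 * p
    expand = solve-∀
    collect : ∀ p → p * p * p + p * p + (p * p + p * p) ≡ p * 1 * (p * 1) * (p + 3)
    collect = solve-∀

  -- p ∣ t, m = p² R:  (m² + mN + p³ w) p ≤ m² (p + 3) when w p ≤ R² (p + 3), using 3 ≤ p.
  descent-case-arith : ∀ p R w → 3 ≤ p → w * p ≤ R * R * (p + 3) →
    (p * (p * R) * (p * (p * R)) + (p * (p * R) * (p * R * 1) + (0 + p * (p * (p * w))))) * p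
      ≤ p * (p * R) * (p * (p * R)) * (p + 3)
  descent-case-arith p R w 3≤p wp≤ = begin
    (p * (p * R) * (p * (p * R)) + (p * (p * R) * (p * R * 1) + (0 + p * (p * (p * w))))) * p
                                                  ≡⟨ expand p R w ⟩
    A + p³ * (w * p)                              ≤⟨ +-monoʳ-≤ A (*-monoʳ-≤ p³ wp≤) ⟩
    A + p³ * (R * R * (p + 3))                    ≡⟨ regroup p R ⟩
    Y + 3 * (p³ * (R * R))                        ≤⟨ +-monoʳ-≤ Y (*-monoˡ-≤ (p³ * (R * R)) 3≤p) ⟩
    Y + p * (p³ * (R * R))                        ≡⟨ collect p R ⟩
    p * (p * R) * (p * (p * R)) * (p + 3)         ∎
    where
    open ≤-Reasoning
    p³ A Y : ℕ
    p³ = p * p * p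
    A = p * p * p³ * (R * R) + p * p³ * (R * R)
    Y = p * p * p³ * (R * R) + 2 * (p * p³ * (R * R))
    expand : ∀ p R w →
      (p * (p * R) * (p * (p * R)) + (p * (p * R) * (p * R * 1) + (0 + p * (p * (p * w))))) * p
      ≡ p * p * (p * p * p) * (R * R) + p * (p * p * p) * (R * R) + p * p * p * (w * p)
    expand = solve-∀
    regroup : ∀ p R →
      p * p * (p * p * p) * (R * R) + p * (p * p * p) * (R * R) + p * p * p * (R * R * (p + 3))
      ≡ p * p * (p * p * p) * (R * R) + 2 * (p * (p * p * p) * (R * R)) + 3 * (p * p * p * (R * R))
    regroup = solve-∀
    collect : ∀ p R →
      p * p * (p * p * p) * (R * R) + 2 * (p * (p * p * p) * (R * R)) + p * (p * p * p * (R * R))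
      ≡ p * (p * R) * (p * (p * R)) * (p + 3)
    collect = solve-∀

module QuadraticCount where

  open import Data.Nat as ℕ using (ℕ; zero; suc; NonZero; _<_; _≤_; _^_; z≤n)
  import Data.Nat.Properties as ℕ
  import Data.Nat.Divisibility as ℕ
  open import Data.Nat.Primality using (Prime; prime⇒nonZero; prime⇒nonTrivial)
  open import Data.Integer as ℤ using (ℤ; +_; _+_; _-_; _*_)
  open import Data.Integer.Properties using (pos-*; pos-+)
  open import Data.Integer.Divisibility.Signed
  open import Data.Integer.Tactic.RingSolver using (solve-∀)
  open import Data.Product using (_×_; _,_; proj₁)
  open import Data.Sum using (_⊎_; inj₁; inj₂)
  open import Relation.Nullary using (¬_; Dec; yes; no)
  open import Relation.Nullary.Decidable using (_×-dec_; ¬?; toSum)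
  open import Relation.Binary.PropositionalEquality

  open FiniteSums
  open Congruences
  open BoundArithmetic

  Q : ℤ → ℤ → ℤ → ℤ
  Q x y z = x * x + + 4 * (y * z)

  Solves : ℕ → ℤ → ℕ → ℕ → ℕ → Set
  Solves q t x y z = + q ∣ Q (+ x) (+ y) (+ z) - t

  solves? : ∀ q t x y z → Dec (Solves q t x y z)
  solves? q t x y z = + q ∣? Q (+ x) (+ y) (+ z) - t

  solutions : ℕ → ℤ → ℕ
  solutions q t = ∑³ q (λ x y z → ⟦ solves? q t x y z ⟧)

  ⟦∣⟧-shift : ∀ q {a b} w → a ≡ b + + q * w → ⟦ + q ∣? a ⟧ ≡ ⟦ + q ∣? b ⟧
  ⟦∣⟧-shift q {b = b} w refl =
    ⟦⟧-cong (λ q∣a → ∣-by-sub q∣a q∣qw (cancel b (+ q * w))) (λ q∣b → ∣-by-add q∣b q∣qw refl) _ _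
    where
    q∣qw : + q ∣ + q * w
    q∣qw = ∣m⇒∣m*n w ∣-refl
    cancel : ∀ b c → b + c - c ≡ b
    cancel = solve-∀

  solves-shift-x : ∀ q t x y z → ⟦ solves? q t (q ℕ.+ x) y z ⟧ ≡ ⟦ solves? q t x y z ⟧
  solves-shift-x q t x y z =
    ⟦∣⟧-shift q (+ q + + 2 * + x)
      (trans (cong (λ X → Q X (+ y) (+ z) - t) (pos-+ q x)) (expand (+ q) (+ x) (+ y) (+ z) t))
    where
    expand : ∀ q x y z t → (q + x) * (q + x) + + 4 * (y * z) - t ≡ (x * x + + 4 * (y * z) - t) + q * (q + + 2 * x)
    expand = solve-∀

  solves-shift-y : ∀ q t x y z → ⟦ solves? q t x (q ℕ.+ y) z ⟧ ≡ ⟦ solves? q t x y z ⟧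
  solves-shift-y q t x y z =
    ⟦∣⟧-shift q (+ 4 * + z)
      (trans (cong (λ Y → Q (+ x) Y (+ z) - t) (pos-+ q y)) (expand (+ q) (+ x) (+ y) (+ z) t))
    where
    expand : ∀ q x y z t → x * x + + 4 * ((q + y) * z) - t ≡ (x * x + + 4 * (y * z) - t) + q * (+ 4 * z)
    expand = solve-∀

  solves-shift-z : ∀ q t x y z → ⟦ solves? q t x y (q ℕ.+ z) ⟧ ≡ ⟦ solves? q t x y z ⟧
  solves-shift-z q t x y z =
    ⟦∣⟧-shift q (+ 4 * + y)
      (trans (cong (λ Z → Q (+ x) (+ y) Z - t) (pos-+ q z)) (expand (+ q) (+ x) (+ y) (+ z) t))
    where
    expand : ∀ q x y z t → x * x + + 4 * (y * (q + z)) - t ≡ (x * x + + 4 * (y * z) - t) + q * (+ 4 * y)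
    expand = solve-∀

  module _ {p : ℕ} (p-prime : Prime p) (p≢2 : ¬ (p ≡ 2)) where

    private
      instance
        p≢0 : NonZero p
        p≢0 = prime⇒nonZero p-prime

    p∣? : ∀ x → Dec (+ p ∣ + x)
    p∣? x = + p ∣? + x

    p∤2 : ¬ (+ p ∣ + 2)
    p∤2 = odd-prime∤2 p-prime p≢2

    p∤4* : ∀ {a} → ¬ (+ p ∣ a) → ¬ (+ p ∣ + 4 * a)
    p∤4* = prime∤* p-prime (prime∤* p-prime p∤2 p∤2)

    cancel-unit : ∀ k {a u v} x y → x < p ^ k → y < p ^ k → ¬ (+ p ∣ a) →
                  + (p ^ k) ∣ u → + (p ^ k) ∣ v → u - v ≡ a * (+ x - + y) → x ≡ y
    cancel-unit k x y x<pᵏ y<pᵏ p∤a pᵏ∣u pᵏ∣v u-v≡ =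
      residue-unique (p ^ k) x y x<pᵏ y<pᵏ (prime-power-cancel p-prime p∤a k (∣-by-sub pᵏ∣u pᵏ∣v u-v≡))

    multiples-count : ∀ N → # p∣? < (N ℕ.* p) ≡ N
    multiples-count N = begin
      # p∣? < (N ℕ.* p)                        ≡⟨ ∑-multiples N p _ (λ i p∤i → ⟦⟧-no (λ p∣i → p∤i (∣⇒∣ᵤ p∣i)) (p∣? i)) ⟩
      ∑ N (λ i → ⟦ p∣? (i ℕ.* p) ⟧)            ≡⟨ ∑-cong N (λ i _ → ⟦⟧-yes (∣ᵤ⇒∣ (ℕ.n∣m*n i)) (p∣? (i ℕ.* p))) ⟩
      ∑ N (λ _ → 1)                           ≡⟨ ∑-const N 1 ⟩
      N ℕ.* 1                                 ≡⟨ ℕ.*-identityʳ N ⟩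
      N                                       ∎
      where open ≡-Reasoning

    root? : ∀ t x → Dec (+ p ∣ + x * + x - t)
    root? t x = + p ∣? + x * + x - t

    -- A square root of t modulo p has at most one companion, namely its negative.
    roots-mod-p : ∀ t → # root? t < p ≤ 2
    roots-mod-p t = count-two p (root? t) (p ℕ.∸_) two-roots
      where
      difference : ∀ x u t → (x * x - t) - (u * u - t) ≡ (x - u) * (x + u)
      difference = solve-∀
      two-roots : ∀ u x → u < p → x < p → + p ∣ + u * + u - t → + p ∣ + x * + x - t → x ≡ u ⊎ x ≡ p ℕ.∸ u
      two-roots u x u<p x<p p∣u²-t p∣x²-t
        with euclid p-prime (+ x - + u) (+ x + + u) (∣-by-sub p∣x²-t p∣u²-t (difference (+ x) (+ u) t))
      ... | inj₁ p∣x-u = inj₁ (residue-unique p x u x<p u<p p∣x-u)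
      ... | inj₂ p∣x+u = residue-of-negation p x u x<p u<p p∣x+u

    -- If p ∣ t, the only square root of t modulo p is 0.
    roots-mod-p-of-multiple : ∀ {t} → + p ∣ t → # root? t < p ≤ 1
    roots-mod-p-of-multiple {t} p∣t =
      count-unique p (root? t) (λ x x′ x<p x′<p r r′ → trans (zero-root x x<p r) (sym (zero-root x′ x′<p r′)))
      where
      cancel : ∀ a t → a - t + t ≡ a
      cancel = solve-∀
      zero-root : ∀ x → x < p → + p ∣ + x * + x - t → x ≡ 0
      zero-root x x<p p∣x²-t = residue-zero p x x<p (prime∣square p-prime (∣-by-add p∣x²-t p∣t (cancel (+ x * + x) t)))

    roots-periodic : ∀ N t → # root? t < (N ℕ.* p) ≡ N ℕ.* # root? t < p
    roots-periodic N t = ∑-periodic N p _ λ i →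
      ⟦∣⟧-shift p (+ p + + 2 * + i) (trans (cong (λ X → X * X - t) (pos-+ p i)) (expand (+ p) (+ i) t))
      where
      expand : ∀ p x t → (p + x) * (p + x) - t ≡ (x * x - t) + p * (p + + 2 * x)
      expand = solve-∀

    module Level (j : ℕ) (t : ℤ) where

      m N : ℕ
      m = p ^ suc j
      N = p ^ j

      p∣m : + p ∣ + m
      p∣m = ∣ᵤ⇒∣ (ℕ.m∣m*n N)

      square-mod-p : ∀ x y z → Solves m t x y z → + p ∣ + y → + p ∣ + x * + x - t
      square-mod-p x y z s p∣y = ∣-by-sub (∣-trans p∣m s) (∣n⇒∣m*n (+ 4) (∣m⇒∣m*n (+ z) p∣y)) (drop (+ x) (+ y) (+ z) t)
        where
        drop : ∀ x y z t → (x * x + + 4 * (y * z) - t) - + 4 * (y * z) ≡ x * x - t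
        drop = solve-∀

      -- The four classes: p ∤ y;  p ∣ y, p ∤ z;  p ∣ y, z and p ∤ x;  p ∣ x, y, z.
      -- Class B also records x² ≡ t (mod p), which every solution with p ∣ y satisfies.
      ClassA ClassB ClassC ClassS : ℕ → ℕ → ℕ → Set
      ClassA x y z = ¬ (+ p ∣ + y) × Solves m t x y z
      ClassB x y z = + p ∣ + x * + x - t × ¬ (+ p ∣ + z) × Solves m t x y z
      ClassC x y z = ¬ (+ p ∣ + x) × + p ∣ + y × + p ∣ + z × Solves m t x y z
      ClassS x y z = + p ∣ + x × + p ∣ + y × + p ∣ + z × Solves m t x y z

      classA? : ∀ x y z → Dec (ClassA x y z)
      classA? x y z = ¬? (p∣? y) ×-dec solves? m t x y z
      classB? : ∀ x y z → Dec (ClassB x y z)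
      classB? x y z = root? t x ×-dec (¬? (p∣? z) ×-dec solves? m t x y z)
      classC? : ∀ x y z → Dec (ClassC x y z)
      classC? x y z = ¬? (p∣? x) ×-dec (p∣? y ×-dec (p∣? z ×-dec solves? m t x y z))
      classS? : ∀ x y z → Dec (ClassS x y z)
      classS? x y z = p∣? x ×-dec (p∣? y ×-dec (p∣? z ×-dec solves? m t x y z))

      #³ : ∀ {P : ℕ → ℕ → ℕ → Set} → (∀ x y z → Dec (P x y z)) → ℕ
      #³ P? = ∑³ m (λ x y z → ⟦ P? x y z ⟧)

      classify : ∀ x y z → Solves m t x y z → ClassA x y z ⊎ ClassB x y z ⊎ ClassC x y z ⊎ ClassS x y z
      classify x y z s with p∣? y
      ... | no p∤y  = inj₁ (p∤y , s)
      ... | yes p∣y with p∣? z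
      ...   | no p∤z  = inj₂ (inj₁ (square-mod-p x y z s p∣y , p∤z , s))
      ...   | yes p∣z with p∣? x
      ...     | no p∤x  = inj₂ (inj₂ (inj₁ (p∤x , p∣y , p∣z , s)))
      ...     | yes p∣x = inj₂ (inj₂ (inj₂ (p∣x , p∣y , p∣z , s)))

      split-into-classes : solutions m t ≤ #³ classA? ℕ.+ (#³ classB? ℕ.+ (#³ classC? ℕ.+ #³ classS?))
      split-into-classes = begin
        solutions m t                                                   ≤⟨ ∑³-mono m (λ x y z _ _ _ → in-some-class x y z) ⟩
        ∑³ m (λ x y z → A x y z ℕ.+ (B x y z ℕ.+ (C x y z ℕ.+ S x y z))) ≡⟨ ∑³-distrib-+ m _ _ ⟩
        #³ classA? ℕ.+ ∑³ m (λ x y z → B x y z ℕ.+ (C x y z ℕ.+ S x y z)) ≡⟨ cong (#³ classA? ℕ.+_) (∑³-distrib-+ m _ _) ⟩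
        #³ classA? ℕ.+ (#³ classB? ℕ.+ ∑³ m (λ x y z → C x y z ℕ.+ S x y z))
                                                                        ≡⟨ cong (λ s → #³ classA? ℕ.+ (#³ classB? ℕ.+ s)) (∑³-distrib-+ m _ _) ⟩
        #³ classA? ℕ.+ (#³ classB? ℕ.+ (#³ classC? ℕ.+ #³ classS?))     ∎
        where
        open ℕ.≤-Reasoning
        A B C S : ℕ → ℕ → ℕ → ℕ
        A x y z = ⟦ classA? x y z ⟧
        B x y z = ⟦ classB? x y z ⟧
        C x y z = ⟦ classC? x y z ⟧
        S x y z = ⟦ classS? x y z ⟧
        in-some-class : ∀ x y z → ⟦ solves? m t x y z ⟧ ≤ A x y z ℕ.+ (B x y z ℕ.+ (C x y z ℕ.+ S x y z))
        in-some-class x y z = ⟦⟧-≤-when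
          (λ s → ⟦⟧-cover₄ (classA? x y z) (classB? x y z) (classC? x y z) (classS? x y z) (classify x y z s))
          (solves? m t x y z)

      m≡N*p : m ≡ N ℕ.* p
      m≡N*p = ℕ.*-comm p N

      -- Class A: for fixed x and y with p ∤ y the congruence is linear in z with unit coefficient 4y.
      classA-count : #³ classA? ≤ m ℕ.* m
      classA-count = begin
        #³ classA?                       ≤⟨ ∑-mono m (λ x _ → ∑-mono m (λ y _ → at-most-one-z x y)) ⟩
        ∑ m (λ _ → ∑ m (λ _ → 1))        ≡⟨ ∑-cong m (λ _ _ → trans (∑-const m 1) (ℕ.*-identityʳ m)) ⟩
        ∑ m (λ _ → m)                    ≡⟨ ∑-const m m ⟩
        m ℕ.* m                          ∎
        where
        open ℕ.≤-Reasoning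
        difference : ∀ x y z z′ t → (x * x + + 4 * (y * z) - t) - (x * x + + 4 * (y * z′) - t) ≡ (+ 4 * y) * (z - z′)
        difference = solve-∀
        at-most-one-z : ∀ x y → ∑ m (λ z → ⟦ classA? x y z ⟧) ≤ 1
        at-most-one-z x y = count-unique m (classA? x y) λ z z′ z<m z′<m (p∤y , s) (_ , s′) →
          cancel-unit (suc j) z z′ z<m z′<m (p∤4* p∤y) s s′ (difference (+ x) (+ y) (+ z) (+ z′) t)

      -- Class B: for fixed x and z with p ∤ z the congruence is linear in y with unit
      -- coefficient 4z, and x must be a square root of t modulo p.
      classB-count : #³ classB? ≤ m ℕ.* # root? t < m
      classB-count = begin
        #³ classB?                                              ≡⟨ ∑³-swap-yz m _ ⟩
        ∑ m (λ x → ∑ m (λ z → ∑ m (λ y → ⟦ classB? x y z ⟧)))   ≤⟨ ∑-mono m (λ x _ → ∑-mono m (λ z _ → at-most-one-y x z)) ⟩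
        ∑ m (λ x → ∑ m (λ _ → ⟦ root? t x ⟧))                   ≡⟨ ∑-cong m (λ x _ → ∑-const m _) ⟩
        ∑ m (λ x → m ℕ.* ⟦ root? t x ⟧)                         ≡⟨ ∑-*ˡ m m _ ⟩
        m ℕ.* # root? t < m                                     ∎
        where
        open ℕ.≤-Reasoning
        difference : ∀ x y y′ z t → (x * x + + 4 * (y * z) - t) - (x * x + + 4 * (y′ * z) - t) ≡ (+ 4 * z) * (y - y′)
        difference = solve-∀
        at-most-one-y : ∀ x z → ∑ m (λ y → ⟦ classB? x y z ⟧) ≤ ⟦ root? t x ⟧
        at-most-one-y x z = count-unique-if m (λ y → classB? x y z) (root? t x)
          (λ y y′ y<m y′<m (_ , p∤z , s) (_ , _ , s′) →
             cancel-unit (suc j) y y′ y<m y′<m (p∤4* p∤z) s s′ (difference (+ x) (+ y) (+ y′) (+ z) t))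
          (λ _ _ → proj₁)

      -- Square roots of t modulo p below m: N periods of at most two, or of at most one if p ∣ t.
      roots-below-m : # root? t < m ≤ N ℕ.* 2
      roots-below-m = ℕ.≤-trans (ℕ.≤-reflexive (trans (cong (# root? t <_) m≡N*p) (roots-periodic N t)))
                                (ℕ.*-monoʳ-≤ N (roots-mod-p t))

      roots-below-m-of-multiple : + p ∣ t → # root? t < m ≤ N ℕ.* 1
      roots-below-m-of-multiple p∣t = ℕ.≤-trans (ℕ.≤-reflexive (trans (cong (# root? t <_) m≡N*p) (roots-periodic N t)))
                                                (ℕ.*-monoʳ-≤ N (roots-mod-p-of-multiple p∣t))

      multiples-below-m : # p∣? < m ≡ N
      multiples-below-m = trans (cong (# p∣? <_) m≡N*p) (multiples-count N)

      -- Class C: for fixed y, z two solutions x, u with p ∤ x, u satisfy (x − u)(x + u) ≡ 0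
      -- (mod m), and p divides at most one factor (as p ∤ 2x), so u ≡ ±x.
      classC-two-roots : ∀ y z u x → u < m → x < m → ClassC u y z → ClassC x y z → x ≡ u ⊎ x ≡ m ℕ.∸ u
      classC-two-roots y z u x u<m x<m (_ , _ , _ , su) (p∤x , _ , _ , sx) with + p ∣? (+ x - + u)
      ... | yes p∣x-u = inj₁ (cancel-unit (suc j) x u x<m u<m p∤x+u sx su (difference (+ x) (+ u) (+ y) (+ z) t))
        where
        difference : ∀ x u y z t → (x * x + + 4 * (y * z) - t) - (u * u + + 4 * (y * z) - t) ≡ (x + u) * (x - u)
        difference = solve-∀
        sum-difference : ∀ x u → (x - u) + (x + u) ≡ + 2 * x
        sum-difference = solve-∀
        p∤x+u : ¬ (+ p ∣ + x + + u)
        p∤x+u p∣x+u = prime∤* p-prime p∤2 p∤x (∣-by-add p∣x-u p∣x+u (sum-difference (+ x) (+ u)))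
      ... | no p∤x-u = residue-of-negation m x u x<m u<m
              (prime-power-cancel p-prime p∤x-u (suc j) (∣-by-sub sx su (difference (+ x) (+ u) (+ y) (+ z) t)))
        where
        difference : ∀ x u y z t → (x * x + + 4 * (y * z) - t) - (u * u + + 4 * (y * z) - t) ≡ (x - u) * (x + u)
        difference = solve-∀

      -- Hence class C has at most 2 N² elements: at most two x for each pair of multiples y, z of p.
      classC-count : #³ classC? ≤ 2 ℕ.* (N ℕ.* N)
      classC-count = begin
        #³ classC?                                                ≡⟨ ∑³-rotate m _ ⟩
        ∑ m (λ y → ∑ m (λ z → ∑ m (λ x → ⟦ classC? x y z ⟧)))     ≤⟨ ∑-mono m (λ y _ → ∑-mono m (λ z _ → at-most-two-x y z)) ⟩
        ∑ m (λ y → ∑ m (λ z → 2 ℕ.* (a y ℕ.* a z)))               ≡⟨ ∑-cong m (λ y _ → trans (∑-*ˡ m 2 _) (cong (2 ℕ.*_) (∑-*ˡ m (a y) a))) ⟩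
        ∑ m (λ y → 2 ℕ.* (a y ℕ.* ∑ m a))                         ≡⟨ trans (∑-*ˡ m 2 _) (cong (2 ℕ.*_) (∑-*ʳ m (∑ m a) a)) ⟩
        2 ℕ.* (∑ m a ℕ.* ∑ m a)                                   ≡⟨ cong (λ k → 2 ℕ.* (k ℕ.* k)) multiples-below-m ⟩
        2 ℕ.* (N ℕ.* N)                                           ∎
        where
        open ℕ.≤-Reasoning
        a : ℕ → ℕ
        a y = ⟦ p∣? y ⟧
        at-most-two-x : ∀ y z → ∑ m (λ x → ⟦ classC? x y z ⟧) ≤ 2 ℕ.* (a y ℕ.* a z)
        at-most-two-x y z with toSum (p∣? y) | toSum (p∣? z)
        ... | inj₁ p∣y | inj₁ p∣z =
          subst (λ k → ∑ m (λ x → ⟦ classC? x y z ⟧) ≤ 2 ℕ.* k) (sym (cong₂ ℕ._*_ (⟦⟧-yes p∣y (p∣? y)) (⟦⟧-yes p∣z (p∣? z))))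
            (count-two m (λ x → classC? x y z) (m ℕ.∸_) (classC-two-roots y z))
        ... | inj₂ p∤y | _ = ℕ.≤-trans (ℕ.≤-reflexive (count-none m (λ x → classC? x y z) (λ _ _ (_ , p∣y , _) → p∤y p∣y))) z≤n
        ... | _ | inj₂ p∤z = ℕ.≤-trans (ℕ.≤-reflexive (count-none m (λ x → classC? x y z) (λ _ _ (_ , _ , p∣z , _) → p∤z p∣z))) z≤n

      -- Class C is empty if p ∣ t: then x² ≡ t ≡ 0 (mod p) forces p ∣ x.
      classC-zero : + p ∣ t → #³ classC? ≡ 0
      classC-zero p∣t = ∑³-zero m _ λ x y z _ _ _ → ⟦⟧-no
        (λ (p∤x , p∣y , _ , s) → p∤x (prime∣square p-prime (∣-by-add (square-mod-p x y z s p∣y) p∣t (cancel (+ x * + x) t))))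
        (classC? x y z)
        where
        cancel : ∀ a t → a - t + t ≡ a
        cancel = solve-∀

      -- Class S is empty unless p ∣ t, since then p ∣ x² + 4yz.
      classS-zero : ¬ (+ p ∣ t) → #³ classS? ≡ 0
      classS-zero p∤t = ∑³-zero m _ λ x y z _ _ _ → ⟦⟧-no
        (λ (p∣x , p∣y , _ , s) → p∤t (∣-by-sub (p∣Q x y z p∣x p∣y) (∣-trans p∣m s) (cancel (Q (+ x) (+ y) (+ z)) t)))
        (classS? x y z)
        where
        cancel : ∀ a t → a - (a - t) ≡ t
        cancel = solve-∀
        p∣Q : ∀ x y z → + p ∣ + x → + p ∣ + y → + p ∣ Q (+ x) (+ y) (+ z)
        p∣Q x y z p∣x p∣y = ∣-by-add (∣m⇒∣m*n (+ x) p∣x) (∣n⇒∣m*n (+ 4) (∣m⇒∣m*n (+ z) p∣y)) refl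

      -- Class S has at most N³ elements, the triples of multiples of p below m.
      classS-count : #³ classS? ≤ N ℕ.* (N ℕ.* N)
      classS-count = begin
        #³ classS?                                 ≤⟨ ∑³-mono m (λ x y z _ _ _ → all-multiples x y z) ⟩
        ∑³ m (λ x y z → a x ℕ.* (a y ℕ.* a z))     ≡⟨ ∑³-product m a ⟩
        ∑ m a ℕ.* (∑ m a ℕ.* ∑ m a)                ≡⟨ cong (λ k → k ℕ.* (k ℕ.* k)) multiples-below-m ⟩
        N ℕ.* (N ℕ.* N)                            ∎
        where
        open ℕ.≤-Reasoning
        a : ℕ → ℕ
        a y = ⟦ p∣? y ⟧
        all-multiples : ∀ x y z → ⟦ classS? x y z ⟧ ≤ a x ℕ.* (a y ℕ.* a z)
        all-multiples x y z = ℕ.≤-trans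
          (⟦⟧-mono (λ (p∣x , p∣y , p∣z , _) → p∣x , p∣y , p∣z) (classS? x y z) (p∣? x ×-dec (p∣? y ×-dec p∣? z)))
          (ℕ.≤-reflexive (trans (⟦⟧-× (p∣? x) _) (cong (a x ℕ.*_) (⟦⟧-× (p∣? y) (p∣? z)))))

    -- At levels k = i + 2 class S descends to the level i below.
    module Descent (i : ℕ) (t : ℤ) where
      open Level (suc i) t

      R : ℕ
      R = p ^ i

      private
        instance
          p²≢0 : NonZero (p ℕ.* p)
          p²≢0 = ℕ.m*n≢0 p p

      m≡R*p² : + m ≡ + R * + (p ℕ.* p)
      m≡R*p² = trans (cong +_ (regroup p R)) (pos-* R (p ℕ.* p))
        where
        open import Data.Nat.Tactic.RingSolver renaming (solve-∀ to solve-ℕ)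
        regroup : ∀ p R → p ℕ.* (p ℕ.* R) ≡ R ℕ.* (p ℕ.* p)
        regroup = solve-ℕ

      p²∣m : + (p ℕ.* p) ∣ + m
      p²∣m = divides (+ R) m≡R*p²

      -- If p divides x, y and z then p² divides x² + 4yz, so class S is empty unless p² ∣ t.
      classS-zero-unless-p² : ¬ (+ (p ℕ.* p) ∣ t) → #³ classS? ≡ 0
      classS-zero-unless-p² p²∤t = ∑³-zero m _ λ x y z _ _ _ → ⟦⟧-no
        (λ (p∣x , p∣y , p∣z , s) → p²∤t (∣-by-sub (p²∣Q x y z p∣x p∣y p∣z) (∣-trans p²∣m s) (cancel (Q (+ x) (+ y) (+ z)) t)))
        (classS? x y z)
        where
        cancel : ∀ a t → a - (a - t) ≡ t
        cancel = solve-∀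
        p²∣Q : ∀ x y z → + p ∣ + x → + p ∣ + y → + p ∣ + z → + (p ℕ.* p) ∣ Q (+ x) (+ y) (+ z)
        p²∣Q x y z p∣x p∣y p∣z = subst (_∣ Q (+ x) (+ y) (+ z)) (sym (pos-* p p))
          (∣-by-add (∣-* p∣x p∣x) (∣n⇒∣m*n (+ 4) (∣-* p∣y p∣z)) refl)

      -- If t = p² t′, the triples (p x, p y, p z) in class S correspond to solutions of
      -- x² + 4yz ≡ t′ (mod R) with x, y, z < N = p R, that is p³ copies of those below R.
      classS-descent : (p²∣t : + (p ℕ.* p) ∣ t) → #³ classS? ≤ p ℕ.* (p ℕ.* (p ℕ.* solutions R (quotient p²∣t)))
      classS-descent (divides t′ t≡t′p²) = begin
        #³ classS?                                                      ≡⟨ cong (λ k → ∑³ k (λ x y z → ⟦ classS? x y z ⟧)) m≡N*p ⟩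
        ∑³ (N ℕ.* p) (λ x y z → ⟦ classS? x y z ⟧)                      ≡⟨ ∑³-multiples N p _ off-multiples ⟩
        ∑³ N (λ x y z → ⟦ classS? (x ℕ.* p) (y ℕ.* p) (z ℕ.* p) ⟧)      ≤⟨ ∑³-mono N (λ x y z _ _ _ → ⟦⟧-mono (descend x y z) _ _) ⟩
        ∑³ (p ℕ.* R) (λ x y z → ⟦ solves? R t′ x y z ⟧)                ≡⟨ ∑³-periodic p R _ (solves-shift-x R t′) (solves-shift-y R t′) (solves-shift-z R t′) ⟩
        p ℕ.* (p ℕ.* (p ℕ.* solutions R t′))                            ∎
        where
        open ℕ.≤-Reasoning
        off-multiples : ∀ x y z → ¬ (p ℕ.∣ x) ⊎ ¬ (p ℕ.∣ y) ⊎ ¬ (p ℕ.∣ z) → ⟦ classS? x y z ⟧ ≡ 0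
        off-multiples x y z (inj₁ p∤x)        = ⟦⟧-no (λ (p∣x , _) → p∤x (∣⇒∣ᵤ p∣x)) (classS? x y z)
        off-multiples x y z (inj₂ (inj₁ p∤y)) = ⟦⟧-no (λ (_ , p∣y , _) → p∤y (∣⇒∣ᵤ p∣y)) (classS? x y z)
        off-multiples x y z (inj₂ (inj₂ p∤z)) = ⟦⟧-no (λ (_ , _ , p∣z , _) → p∤z (∣⇒∣ᵤ p∣z)) (classS? x y z)
        scale : ∀ x y z p t′ → (x * p) * (x * p) + + 4 * ((y * p) * (z * p)) - t′ * (p * p)
                               ≡ (x * x + + 4 * (y * z) - t′) * (p * p)
        scale = solve-∀
        scaled : ∀ x y z → Q (+ (x ℕ.* p)) (+ (y ℕ.* p)) (+ (z ℕ.* p)) - t ≡ (Q (+ x) (+ y) (+ z) - t′) * + (p ℕ.* p)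
        scaled x y z =
          trans (cong₂ _-_ (cong₂ (λ X YZ → X * X + + 4 * YZ) (pos-* x p) (cong₂ _*_ (pos-* y p) (pos-* z p)))
                           (trans t≡t′p² (cong (t′ *_) (pos-* p p))))
          (trans (scale (+ x) (+ y) (+ z) (+ p) t′) (cong ((Q (+ x) (+ y) (+ z) - t′) *_) (sym (pos-* p p))))
        descend : ∀ x y z → ClassS (x ℕ.* p) (y ℕ.* p) (z ℕ.* p) → Solves R t′ x y z
        descend x y z (_ , _ , _ , s) = *-cancelʳ-∣ (+ (p ℕ.* p)) (subst₂ _∣_ m≡R*p² (scaled x y z) s)

    SolutionBound : ℕ → ℤ → Set
    SolutionBound k t = solutions (p ^ k) t ℕ.* p ≤ p ^ (2 ℕ.* k) ℕ.* (p ℕ.+ 3)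

    private
      2≤p : 2 ≤ p
      2≤p = ℕ.nonTrivial⇒n>1 p {{prime⇒nonTrivial p-prime}}

      3≤p : 3 ≤ p
      3≤p = ℕ.≤∧≢⇒< 2≤p (λ 2≡p → p≢2 (sym 2≡p))

      +-mono-≤₄ : ∀ {a b c d a′ b′ c′ d′} → a ≤ a′ → b ≤ b′ → c ≤ c′ → d ≤ d′ →
                  a ℕ.+ (b ℕ.+ (c ℕ.+ d)) ≤ a′ ℕ.+ (b′ ℕ.+ (c′ ℕ.+ d′))
      +-mono-≤₄ a≤ b≤ c≤ d≤ = ℕ.+-mono-≤ a≤ (ℕ.+-mono-≤ b≤ (ℕ.+-mono-≤ c≤ d≤))

      conclude : ∀ k t {B} → solutions (p ^ k) t ≤ B → B ℕ.* p ≤ p ^ k ℕ.* p ^ k ℕ.* (p ℕ.+ 3) → SolutionBound k t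
      conclude k t sol≤B Bp≤ =
        ℕ.≤-trans (ℕ.*-monoˡ-≤ p sol≤B) (ℕ.≤-trans Bp≤ (ℕ.≤-reflexive (cong (ℕ._* (p ℕ.+ 3)) (sym (^-double p k)))))

    -- p ∤ t: classes A, B and C contribute m² + 2mN + 2N², class S nothing.
    unit-case : ∀ j t → ¬ (+ p ∣ t) → SolutionBound (suc j) t
    unit-case j t p∤t = conclude (suc j) t
      (ℕ.≤-trans split-into-classes
        (+-mono-≤₄ classA-count (ℕ.≤-trans classB-count (ℕ.*-monoʳ-≤ m roots-below-m)) classC-count (ℕ.≤-reflexive (classS-zero p∤t))))
      (unit-case-arith p N 2≤p)
      where open Level j t

    -- p ∣ t modulo p: p² + p + 1 solutions at most.
    first-level-case : ∀ t → + p ∣ t → SolutionBound 1 t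
    first-level-case t p∣t = conclude 1 t
      (ℕ.≤-trans split-into-classes
        (+-mono-≤₄ classA-count (ℕ.≤-trans classB-count (ℕ.*-monoʳ-≤ m (roots-below-m-of-multiple p∣t)))
                   (ℕ.≤-reflexive (classC-zero p∣t)) classS-count))
      (base-case-arith p (ℕ.≤-trans (ℕ.s≤s z≤n) 2≤p))
      where open Level 0 t

    descent-case : ∀ i t {w} → + p ∣ t → (let open Level (suc i) t in #³ classS? ≤ p ℕ.* (p ℕ.* (p ℕ.* w))) →
                w ℕ.* p ≤ p ^ (2 ℕ.* i) ℕ.* (p ℕ.+ 3) → SolutionBound (suc (suc i)) t
    descent-case i t {w} p∣t classS≤ wp≤ = conclude (suc (suc i)) t
      (ℕ.≤-trans split-into-classes
        (+-mono-≤₄ classA-count (ℕ.≤-trans classB-count (ℕ.*-monoʳ-≤ m (roots-below-m-of-multiple p∣t)))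
                   (ℕ.≤-reflexive (classC-zero p∣t)) classS≤))
      (descent-case-arith p (p ^ i) w 3≤p (ℕ.≤-trans wp≤ (ℕ.≤-reflexive (cong (ℕ._* (p ℕ.+ 3)) (^-double p i)))))
      where open Level (suc i) t

    -- Induction on k (modulo 1 the only triple is (0, 0, 0)), descending two levels when p² ∣ t.
    solutions-bound : ∀ k t → SolutionBound k t
    solutions-bound zero t =
      conclude 0 t (∑³-mono 1 {g = λ _ _ _ → 1} (λ x y z _ _ _ → ⟦⟧-≤1 (solves? 1 t x y z))) (ℕ.*-monoʳ-≤ 1 (ℕ.m≤m+n p 3))
    solutions-bound (suc zero) t with + p ∣? t
    ... | no p∤t  = unit-case 0 t p∤t
    ... | yes p∣t = first-level-case t p∣t
    solutions-bound (suc (suc i)) t with + p ∣? t | + (p ℕ.* p) ∣? t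
    ... | no p∤t  | _         = unit-case (suc i) t p∤t
    ... | yes p∣t | no p²∤t  = descent-case i t {0} p∣t (ℕ.≤-trans (ℕ.≤-reflexive (Descent.classS-zero-unless-p² i t p²∤t)) z≤n) z≤n
    ... | yes p∣t | yes p²∣t = descent-case i t p∣t (Descent.classS-descent i t p²∣t) (solutions-bound i (quotient p²∣t))

module MatrixCount where

  open import Defs
  open import Data.Nat as ℕ using (ℕ; NonZero; _<_; _≤_; _^_; z≤n)
  import Data.Nat.Properties as ℕ
  open import Data.Nat.DivMod using (_%_; _/_; m≡m%n+[m/n]*n; m%n<n; _mod_)
  open import Data.Nat.Primality using (Prime)
  open import Data.Fin using (Fin; toℕ)
  open import Data.Fin.Properties using (toℕ-fromℕ<; toℕ<n; _≟_)
  open import Data.Integer as ℤ using (ℤ; +_; _+_; _-_; _*_)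
  open import Data.Integer.Properties using (pos-*; pos-+; m-n≡m⊖n; ⊖-≥)
  open import Data.Integer.Divisibility.Signed
  open import Data.Integer.Tactic.RingSolver using (solve-∀)
  open import Data.Product using (_×_; _,_)
  open import Relation.Nullary using (¬_; Dec)
  open import Relation.Nullary.Decidable using (_×-dec_; toSum)
  open import Data.Sum using (inj₁; inj₂)
  open import Relation.Binary.PropositionalEquality

  open FiniteSums
  open Congruences
  open QuadraticCount

  ⟨_⟩ : ∀ {m} → Fin m → ℤ
  ⟨ a ⟩ = + toℕ a

  -- The discriminant r² − 4d of the characteristic polynomial x² − r x + d.
  discriminant : ∀ {m} → Fin m → Fin m → ℤ
  discriminant r d = ⟨ r ⟩ * ⟨ r ⟩ - + 4 * ⟨ d ⟩

  module _ (m : ℕ) .{{_ : NonZero m}} where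

    mod-congruent : ∀ x → + m ∣ + x - ⟨ x mod m ⟩
    mod-congruent x = divides (+ (x / m)) (begin
      + x - ⟨ x mod m ⟩                          ≡⟨ cong₂ (λ a b → + a - + b) (m≡m%n+[m/n]*n x m) (toℕ-fromℕ< (m%n<n x m)) ⟩
      + (x % m ℕ.+ x / m ℕ.* m) - + (x % m)      ≡⟨ cong (_- + (x % m)) (pos-+ (x % m) _) ⟩
      + (x % m) + + (x / m ℕ.* m) - + (x % m)    ≡⟨ cancel (+ (x % m)) (+ (x / m ℕ.* m)) ⟩
      + (x / m ℕ.* m)                            ≡⟨ pos-* (x / m) m ⟩
      + (x / m) * + m                            ∎)
      where
      open ≡-Reasoning
      cancel : ∀ a b → a + b - a ≡ b
      cancel = solve-∀

    mod-≡ : ∀ x (y : Fin m) → x mod m ≡ y → + m ∣ + x - ⟨ y ⟩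
    mod-≡ x y refl = mod-congruent x

    trace-congruence : ∀ a b c e r → tr (a , b , c , e) ≡ r → + m ∣ ⟨ a ⟩ + ⟨ e ⟩ - ⟨ r ⟩
    trace-congruence a b c e r tr≡r = subst (λ s → + m ∣ s - ⟨ r ⟩) (pos-+ (toℕ a) (toℕ e)) (mod-≡ _ r tr≡r)

    det-congruence : ∀ a b c e d → det (a , b , c , e) ≡ d → + m ∣ ⟨ a ⟩ * ⟨ e ⟩ - ⟨ b ⟩ * ⟨ c ⟩ - ⟨ d ⟩
    det-congruence a b c e d det≡d =
      subst₂ (λ ae bc → + m ∣ ae - bc - ⟨ d ⟩) (pos-* (toℕ a) (toℕ e)) (pos-* (toℕ b) (toℕ c))
        (∣-by-sub (∣-by-sub (∣-by-add (mod-congruent _) difference refl) (mod-congruent _) refl) ∣-refl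
          (regroup (+ (toℕ a ℕ.* toℕ e)) ⟨ a *ₘ e ⟩ (+ m) ⟨ b *ₘ c ⟩ ⟨ d ⟩ (+ (toℕ b ℕ.* toℕ c))))
      where
      regroup : ∀ ae u m v d bc → (ae - u) + ((u + (m - v)) - d) - (bc - v) - m ≡ ae - bc - d
      regroup = solve-∀
      m-v≡ : + (m ℕ.∸ toℕ (b *ₘ c)) ≡ + m - ⟨ b *ₘ c ⟩
      m-v≡ = sym (trans (m-n≡m⊖n m (toℕ (b *ₘ c))) (⊖-≥ (ℕ.<⇒≤ (toℕ<n (b *ₘ c)))))
      difference : + m ∣ (⟨ a *ₘ e ⟩ + (+ m - ⟨ b *ₘ c ⟩)) - ⟨ d ⟩
      difference = subst (λ s → + m ∣ s - ⟨ d ⟩) (trans (pos-+ (toℕ (a *ₘ e)) _) (cong (λ s → ⟨ a *ₘ e ⟩ + s) m-v≡))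
                     (mod-≡ _ d det≡d)

    -- Since (a + e)² − 4(ae − bc) = (a − e)² + 4bc, a matrix with trace r and
    -- determinant d satisfies (a − e)² + 4bc ≡ r² − 4d.
    discriminant-congruence : ∀ a b c e r d → + m ∣ a + e - r → + m ∣ a * e - b * c - d →
                              + m ∣ Q (a - e) b c - (r * r - + 4 * d)
    discriminant-congruence a b c e r d m∣tr m∣det =
      ∣-by-sub (∣m⇒∣m*n (a + e + r) m∣tr) (∣n⇒∣m*n (+ 4) m∣det) (identity a e b c r d)
      where
      identity : ∀ a e b c r d → (a + e - r) * (a + e + r) - + 4 * (a * e - b * c - d)
                                 ≡ (a - e) * (a - e) + + 4 * (b * c) - (r * r - + 4 * d)
      identity = solve-∀

    module Pairs (r d : Fin m) where

      trace? : ∀ a e → Dec (+ m ∣ + a + + e - ⟨ r ⟩)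
      trace? a e = + m ∣? + a + + e - ⟨ r ⟩

      completions : ℤ → ℕ
      completions X = ∑ m (λ b → ∑ m (λ c → ⟦ + m ∣? Q X (+ b) (+ c) - discriminant r d ⟧))

      completions-mod : ∀ X Y → + m ∣ X - Y → completions X ≡ completions Y
      completions-mod X Y m∣X-Y = ∑-cong m λ b _ → ∑-cong m λ c _ → ⟦⟧-cong
        (λ m∣X → ∣-by-sub m∣X (∣m⇒∣m*n (X + Y) m∣X-Y) (shift X Y (+ b) (+ c) (discriminant r d)))
        (λ m∣Y → ∣-by-add m∣Y (∣m⇒∣m*n (X + Y) m∣X-Y) (unshift X Y (+ b) (+ c) (discriminant r d))) _ _
        where
        shift : ∀ X Y b c D → (X * X + + 4 * (b * c) - D) - (X - Y) * (X + Y) ≡ Y * Y + + 4 * (b * c) - D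
        shift = solve-∀
        unshift : ∀ X Y b c D → (Y * Y + + 4 * (b * c) - D) + (X - Y) * (X + Y) ≡ X * X + + 4 * (b * c) - D
        unshift = solve-∀

      count-by-pairs : countTrDet m r d ≤ ∑ m (λ a → ∑ m (λ e → ⟦ trace? a e ⟧ ℕ.* completions (+ a - + e)))
      count-by-pairs = begin
        countTrDet m r d                                          ≡⟨ length-filter _ (allMat2 m) ⟩
        ∑ᴸ (allMat2 m) (λ A → ⟦ (tr A ≟ r) ×-dec (det A ≟ d) ⟧)   ≤⟨ ∑ᴸ-mono (allMat2 m) (λ (a , b , c , e) → congruences a b c e) ⟩
        ∑ᴸ (allMat2 m) (λ (a , b , c , e) → G (toℕ a) (toℕ b) (toℕ c) (toℕ e))
                                                                  ≡⟨ ∑ᴸ-allMat2 ⟩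
        ∑ m (λ a → ∑ m λ b → ∑ m λ c → ∑ m λ e → G a b c e)      ≡⟨ ∑-cong m (λ a _ → factor a) ⟩
        ∑ m (λ a → ∑ m (λ e → ⟦ trace? a e ⟧ ℕ.* completions (+ a - + e))) ∎
        where
        open ℕ.≤-Reasoning
        G : ℕ → ℕ → ℕ → ℕ → ℕ
        G a b c e = ⟦ trace? a e ×-dec (+ m ∣? Q (+ a - + e) (+ b) (+ c) - discriminant r d) ⟧
        congruences : ∀ a b c e → ⟦ (tr (a , b , c , e) ≟ r) ×-dec (det (a , b , c , e) ≟ d) ⟧
                                  ≤ G (toℕ a) (toℕ b) (toℕ c) (toℕ e)
        congruences a b c e = ⟦⟧-mono
          (λ (tr≡r , det≡d) →
             let m∣tr = trace-congruence a b c e r tr≡r in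
             m∣tr , discriminant-congruence ⟨ a ⟩ ⟨ b ⟩ ⟨ c ⟩ ⟨ e ⟩ ⟨ r ⟩ ⟨ d ⟩ m∣tr (det-congruence a b c e d det≡d)) _ _
        ∑ᴸ-allMat2 : ∑ᴸ (allMat2 m) (λ (a , b , c , e) → G (toℕ a) (toℕ b) (toℕ c) (toℕ e))
                     ≡ ∑ m (λ a → ∑ m λ b → ∑ m λ c → ∑ m λ e → G a b c e)
        ∑ᴸ-allMat2 = trans (∑ᴸ-allFin-× m _ _) (∑-cong m λ a _ → trans (∑ᴸ-allFin-× m _ _)
                       (∑-cong m λ b _ → trans (∑ᴸ-allFin-× m _ _) (∑-cong m λ c _ → ∑ᴸ-allFin m _)))
        factor : ∀ a → (∑ m λ b → ∑ m λ c → ∑ m λ e → G a b c e) ≡ ∑ m (λ e → ⟦ trace? a e ⟧ ℕ.* completions (+ a - + e))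
        factor a = trans (sym (∑³-rotate m (λ e b c → G a b c e))) (∑-cong m λ e _ →
          trans (∑-cong m (λ b _ → trans (∑-cong m (λ c _ → ⟦⟧-× (trace? a e) _)) (∑-*ˡ m ⟦ trace? a e ⟧ _)))
                (∑-*ˡ m ⟦ trace? a e ⟧ _))

  module _ {p : ℕ} (p-prime : Prime p) (p≢2 : ¬ (p ≡ 2)) (n : ℕ) .{{_ : NonZero (p ^ n)}} where

    private
      q : ℕ
      q = p ^ n

    -- As 2 is invertible modulo pⁿ, a pair (a, e) with a + e ≡ r is determined by the
    -- residue of a − e.
    ∑-trace-pairs : ∀ r (g : ℤ → ℕ) → (∀ X Y → + q ∣ X - Y → g X ≡ g Y) →
                    ∑ q (λ a → ∑ q (λ e → ⟦ + q ∣? + a + + e - r ⟧ ℕ.* g (+ a - + e))) ≤ ∑ q (λ x → g (+ x))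
    ∑-trace-pairs r g g-mod = begin
      ∑ q (λ a → ∑ q (λ e → ⟦ trace? a e ⟧ ℕ.* g (+ a - + e)))       ≤⟨ ∑-mono q (λ a _ → ∑-mono q (λ e _ → to-residue a e)) ⟩
      ∑ q (λ a → ∑ q (λ e → ∑ q (λ x → ⟦ pair? a e x ⟧ ℕ.* g (+ x)))) ≡⟨ sym (∑³-rotate q (λ x a e → ⟦ pair? a e x ⟧ ℕ.* g (+ x))) ⟩
      ∑ q (λ x → ∑ q (λ a → ∑ q (λ e → ⟦ pair? a e x ⟧ ℕ.* g (+ x)))) ≡⟨ ∑-cong q (λ x _ → trans (∑-cong q (λ a _ → ∑-*ʳ q _ _)) (∑-*ʳ q _ _)) ⟩
      ∑ q (λ x → pairs x ℕ.* g (+ x))                                 ≤⟨ ∑-mono q (λ x _ → ℕ.*-monoˡ-≤ (g (+ x)) (unique-pair x)) ⟩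
      ∑ q (λ x → 1 ℕ.* g (+ x))                                       ≡⟨ ∑-cong q (λ x _ → ℕ.*-identityˡ (g (+ x))) ⟩
      ∑ q (λ x → g (+ x))                                             ∎
      where
      open ℕ.≤-Reasoning
      trace? : ∀ a e → Dec (+ q ∣ + a + + e - r)
      trace? a e = + q ∣? + a + + e - r
      pair? : ∀ a e x → Dec (+ q ∣ + a + + e - r × + q ∣ + x - (+ a - + e))
      pair? a e x = trace? a e ×-dec (+ q ∣? + x - (+ a - + e))
      pairs : ℕ → ℕ
      pairs x = ∑ q (λ a → ∑ q (λ e → ⟦ pair? a e x ⟧))

      to-residue : ∀ a e → ⟦ trace? a e ⟧ ℕ.* g (+ a - + e) ≤ ∑ q (λ x → ⟦ pair? a e x ⟧ ℕ.* g (+ x))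
      to-residue a e with toSum (trace? a e) | residue q (+ a - + e)
      ... | inj₂ ¬tr | _ = ℕ.≤-trans (ℕ.≤-reflexive (cong (ℕ._* g (+ a - + e)) (⟦⟧-no ¬tr (trace? a e)))) z≤n
      ... | inj₁ tr  | x , x<q , q∣x-[a-e] = ℕ.≤-trans
        (ℕ.≤-reflexive (cong₂ ℕ._*_ (trans (⟦⟧-yes tr (trace? a e)) (sym (⟦⟧-yes (tr , q∣x-[a-e]) (pair? a e x))))
                                    (sym (g-mod _ _ q∣x-[a-e]))))
        (∑-term q (λ x → ⟦ pair? a e x ⟧ ℕ.* g (+ x)) x x<q)

      e-determined : ∀ a e e′ → + a + + e - r - (+ a + + e′ - r) ≡ + e - + e′
      e-determined = λ a e e′ → identity (+ a) (+ e) (+ e′) r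
        where
        identity : ∀ a e e′ r → a + e - r - (a + e′ - r) ≡ e - e′
        identity = solve-∀
      twice-a : ∀ a e x → (+ a + + e - r) - (+ x - (+ a - + e)) ≡ + 2 * + a - (r + + x)
      twice-a a e x = identity (+ a) (+ e) r (+ x)
        where
        identity : ∀ a e r x → (a + e - r) - (x - (a - e)) ≡ + 2 * a - (r + x)
        identity = solve-∀
      a-determined : ∀ a a′ w → (+ 2 * + a - w) - (+ 2 * + a′ - w) ≡ + 2 * (+ a - + a′)
      a-determined a a′ w = identity (+ a) (+ a′) w
        where
        identity : ∀ a a′ w → (+ 2 * a - w) - (+ 2 * a′ - w) ≡ + 2 * (a - a′)
        identity = solve-∀

      -- Each residue x comes from at most one pair: 2a ≡ r + x fixes a, then a + e ≡ r fixes e.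
      unique-pair : ∀ x → pairs x ≤ 1
      unique-pair x = ℕ.≤-trans (∑-mono q (λ a _ → e-unique a))
        (count-unique q (λ a → + q ∣? + 2 * + a - (r + + x)) λ a a′ a<q a′<q h h′ →
          cancel-unit p-prime p≢2 n a a′ a<q a′<q (p∤2 p-prime p≢2) h h′ (a-determined a a′ (r + + x)))
        where
        e-unique : ∀ a → ∑ q (λ e → ⟦ pair? a e x ⟧) ≤ ⟦ + q ∣? + 2 * + a - (r + + x) ⟧
        e-unique a = count-unique-if q (λ e → pair? a e x) _
          (λ e e′ e<q e′<q (tr , _) (tr′ , _) → residue-unique q e e′ e<q e′<q (∣-by-sub tr tr′ (e-determined a e e′)))
          (λ e _ (tr , q∣x-[a-e]) → ∣-by-sub tr q∣x-[a-e] (twice-a a e x))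

    matrices≤solutions : ∀ r d → countTrDet q r d ≤ solutions q (discriminant r d)
    matrices≤solutions r d = ℕ.≤-trans count-by-pairs (∑-trace-pairs ⟨ r ⟩ completions completions-mod)
      where open Pairs q r d

open import Defs
open import Data.Nat using (ℕ; _+_; _*_; _^_; _≤_; _≥_; NonZero)
open import Data.Nat.Primality using (Prime)
open import Data.Fin using (Fin)
open import Relation.Nullary using (¬_)
open import Relation.Binary.PropositionalEquality using (_≡_)
import Data.Nat.Properties as ℕ
open QuadraticCount using (solutions-bound)
open MatrixCount using (matrices≤solutions; discriminant)

lemma6p2 : (p n : ℕ) → Prime p → ¬ (p ≡ 2) → n ≥ 1 →
    .{{_ : NonZero (p ^ n)}} →
    (r d : Fin (p ^ n)) → IsUnit d →
    countTrDet (p ^ n) r d * p ≤ p ^ (2 * n) * (p + 3)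
lemma6p2 p n p-prime p≢2 _ r d _ =
  ℕ.≤-trans (ℕ.*-monoˡ-≤ p (matrices≤solutions p-prime p≢2 n r d))
            (solutions-bound p-prime p≢2 n (discriminant r d))
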